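{- For every positive integer $n$, during a complete run of $\mathrm{AccelAsc}(n)$, the write statements executed after initialisation are "$a_k\leftarrow x$" (in both inner loops), "$a_\ell\leftarrow y$" and "$a_k\leftarrow y+1$". Together they are executed a total of exactly $2p(n)-1$ times.
   Context: $p(n)$ denotes the number of partitions of $n$, with the conventions $p(0)=1$ and $p(j)=0$ for $j<0$. The procedure $\mathrm{AccelAsc}(n)$, for $n\ge1$, operates on an array $a$ as follows and visits every ascending composition of $n$ (a sequence of positive integers in nondecreasing order summing to $n$) exactly once: 1. Initialisation: $k\leftarrow 2$; $a_1\leftarrow 0$; $y\leftarrow n-1$. 2. While $k\ne 1$: - $k\leftarrow k-1$; $x\leftarrow a_k+1$. - While $2x\le y$: $a_k\leftarrow x$; $y\leftarrow y-x$; $k\leftarrow k+1$. - $\ell\leftarrow k+1$. - While $x\le y$: $a_k\leftarrow x$; $a_\ell\leftarrow y$; visit $\langle a_1,\dots,a_\ell\rangle$; $x\leftarrow x+1$; $y\leftarrow y-1$. - $y\leftarrow y+x-1$; $a_k\leftarrow y+1$; visit $\langle a_1,\dots,a_k\rangle$. -}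

module Defs where

open import Data.Nat using (ℕ; zero; suc; _+_; _*_; _∸_; _≤_; _≤?_; _≟_)
open import Data.Bool using (Bool; true; false; _∧_; if_then_else_)
open import Data.List using (List; []; _∷_; length; filter; map; concatMap; upTo)
open import Data.Nat.ListAction using (sum)
open import Data.Maybe using (Maybe; just; nothing)
open import Relation.Nullary.Decidable using (⌊_⌋; yes; no)

-- Partitions.  p(n) = number of partitions of n, i.e. the number of
-- sequences of positive integers in nondecreasing order summing to n
-- (ascending compositions).  We enumerate all lists of length ≤ n with
-- entries in {1,…,n} (each list occurs exactly once) and count those
-- that are nondecreasing and sum to n.

listsOfLength : ℕ → ℕ → List (List ℕ)
listsOfLength n zero    = [] ∷ []
listsOfLength n (suc m) =
  concatMap (λ i → map (λ xs → suc i ∷ xs) (listsOfLength n m)) (upTo n)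

candidates : ℕ → List (List ℕ)
candidates n = concatMap (listsOfLength n) (upTo (suc n))

nondecreasing? : List ℕ → Bool
nondecreasing? []           = true
nondecreasing? (x ∷ [])     = true
nondecreasing? (x ∷ y ∷ xs) = ⌊ x ≤? y ⌋ ∧ nondecreasing? (y ∷ xs)

isPartitionOf? : ℕ → List ℕ → Bool
isPartitionOf? n xs = nondecreasing? xs ∧ ⌊ sum xs ≟ n ⌋

p : ℕ → ℕ
p n = length (filter (λ xs → isPartitionOf? n xs Data.Bool.≟ true) (candidates n))

-- AccelAsc(n) as a small-step machine.  The array a is modelled as a
-- function ℕ → ℕ (indices from 1).  The counter `writes` counts the
-- executions of the write statements after initialisation:
-- "a_k ← x" (in both inner loops), "a_ℓ ← y" and "a_k ← y+1".
-- Visits do not modify the state.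

data PC : Set where
  outer : PC   -- test of "while k ≠ 1"
  loop1 : PC   -- test of "while 2x ≤ y"
  loop2 : PC   -- test of "while x ≤ y"
  halt  : PC

record State : Set where
  constructor st
  field
    pc     : PC
    arr    : ℕ → ℕ
    k      : ℕ
    x      : ℕ
    y      : ℕ
    ℓ      : ℕ
    writes : ℕ

upd : (ℕ → ℕ) → ℕ → ℕ → (ℕ → ℕ)
upd a i v j = if ⌊ j ≟ i ⌋ then v else a j

-- Initialisation: k ← 2; a₁ ← 0; y ← n − 1  (not counted).
initState : ℕ → State
initState n = st outer (upd (λ _ → 0) 1 0) 2 0 (n ∸ 1) 0 0

step : State → State
step (st outer a k x y l w) with k ≟ 1
... | yes _ = st halt a k x y l w
... | no _ =
      let k′ = k ∸ 1 in st loop1 a k′ (a k′ + 1) y l w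
step (st loop1 a k x y l w) with (2 * x) ≤? y
... | yes _ = st loop1 (upd a k x) (suc k) x (y ∸ x) l (suc w)
... | no _ = st loop2 a k x y (suc k) w
step (st loop2 a k x y l w) with x ≤? y
... | yes _ =
      -- a_k ← x; a_ℓ ← y; visit; x ← x+1; y ← y−1
      st loop2 (upd (upd a k x) l y) k (suc x) (y ∸ 1) l (2 + w)
... | no _ =
      -- y ← y+x−1; a_k ← y+1; visit
      let y′ = y + x ∸ 1 in st outer (upd a k (suc y′)) k x y′ l (suc w)
step s@(st halt _ _ _ _ _ _) = s

run : ℕ → State → Maybe ℕ
run _          (st halt _ _ _ _ _ w) = just w
run zero       _                     = nothing
run (suc fuel) s                     = run fuel (step s)

-- Let asc x t be the number of ascending compositions of t whose parts are
-- all at least x.  Classifying them by whether the first part is x gives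
--   asc x (x + y) = asc x y + asc (x + 1) (x + y)        (1 ≤ x),
-- together with asc x 0 = 1, asc x t = 0 for 0 < t < x, and
-- asc x (x + d) = 1 for d < x (the composition ⟨x + d⟩ alone).
-- AccelAsc is this recursion unrolled.  Entering the inner loops with
-- candidate part x and remaining sum y at level k, the procedure comes back
-- to the outer test at level k with a_k = x + y after exactly
-- 2·asc x (x + y) − 1 writes: the first loop writes once and recurses on
-- both summands of the identity, while the second loop (reached when
-- y < 2x) writes twice per two-part composition ⟨x′, t − x′⟩ and once for ⟨t⟩.

module Submission where

open import Defs
open import Data.Nat using (ℕ; zero; suc; _+_; _*_; _∸_; _≤_; _<_; _≤?_; _≟_; s≤s; z<s)
open import Data.Nat.Properties
open import Data.Nat.Tactic.RingSolver using (solve-∀)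
open import Algebra.Properties.CommutativeSemigroup +-commutativeSemigroup using (x∙yz≈y∙xz)
open import Data.Bool using (Bool; true; false; _∧_; if_then_else_)
open import Data.Bool.Properties using (∧-assoc; ∧-zeroʳ)
import Data.Bool as Bool
open import Data.List using (List; []; _∷_; length; filter; map; concatMap; applyUpTo; _++_)
open import Data.Nat.ListAction using (sum)
open import Data.Maybe using (just)
open import Data.Product using (∃-syntax; _,_; map₂)
open import Function using (_∘_)
open import Relation.Nullary using (¬_; Dec; yes; no; contradiction)
open import Relation.Nullary.Decidable using (⌊_⌋; isYes≗does; dec-true; dec-false)
open import Relation.Binary.PropositionalEquality

⌊⌋-true : {A : Set} (d : Dec A) → A → ⌊ d ⌋ ≡ true
⌊⌋-true d a = trans (isYes≗does d) (dec-true d a)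

⌊⌋-false : {A : Set} (d : Dec A) → ¬ A → ⌊ d ⌋ ≡ false
⌊⌋-false d ¬a = trans (isYes≗does d) (dec-false d ¬a)

⌊⌋-cong : {A B : Set} (a? : Dec A) (b? : Dec B) → (A → B) → (B → A) → ⌊ a? ⌋ ≡ ⌊ b? ⌋
⌊⌋-cong a? (yes b) _ B→A = ⌊⌋-true a? (B→A b)
⌊⌋-cong a? (no ¬b) A→B _ = ⌊⌋-false a? (¬b ∘ A→B)

_when_ : ℕ → Bool → ℕ
v when b = if b then v else 0

count : {A : Set} → (A → Bool) → List A → ℕ
count f []       = 0
count f (x ∷ xs) = if f x then suc (count f xs) else count f xs

length-filter≡count : {A : Set} (f : A → Bool) (xs : List A) →
  length (filter (λ x → f x Bool.≟ true) xs) ≡ count f xs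
length-filter≡count f []       = refl
length-filter≡count f (x ∷ xs) with f x
... | true  = cong suc (length-filter≡count f xs)
... | false = length-filter≡count f xs

count-++ : {A : Set} (f : A → Bool) (xs ys : List A) →
  count f (xs ++ ys) ≡ count f xs + count f ys
count-++ f []       ys = refl
count-++ f (x ∷ xs) ys with f x
... | true  = cong suc (count-++ f xs ys)
... | false = count-++ f xs ys

count-map : {A B : Set} (f : A → Bool) (g : B → A) (xs : List B) →
  count f (map g xs) ≡ count (f ∘ g) xs
count-map f g []       = refl
count-map f g (x ∷ xs) with f (g x)
... | true  = cong suc (count-map f g xs)
... | false = count-map f g xs

count-cong : {A : Set} {f g : A → Bool} → (∀ x → f x ≡ g x) → (xs : List A) →
  count f xs ≡ count g xs
count-cong f≗g []       = refl
count-cong {g = g} f≗g (x ∷ xs) rewrite f≗g x with g x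
... | true  = cong suc (count-cong f≗g xs)
... | false = count-cong f≗g xs

count-guard : {A : Set} (b : Bool) (f : A → Bool) (xs : List A) →
  count (λ x → b ∧ f x) xs ≡ count f xs when b
count-guard true  f xs       = refl
count-guard false f []       = refl
count-guard false f (x ∷ xs) = count-guard false f xs

Σ : ℕ → (ℕ → ℕ) → ℕ
Σ zero    f = 0
Σ (suc n) f = f 0 + Σ n (f ∘ suc)

Σ-cong : ∀ n {f g : ℕ → ℕ} → (∀ i → f i ≡ g i) → Σ n f ≡ Σ n g
Σ-cong zero    f≗g = refl
Σ-cong (suc n) f≗g = cong₂ _+_ (f≗g 0) (Σ-cong n (f≗g ∘ suc))

Σ-zero : ∀ n {f : ℕ → ℕ} → (∀ i → f i ≡ 0) → Σ n f ≡ 0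
Σ-zero zero    f≗0 = refl
Σ-zero (suc n) f≗0 = cong₂ _+_ (f≗0 0) (Σ-zero n (f≗0 ∘ suc))

Σ-+ : ∀ n (f g : ℕ → ℕ) → Σ n (λ i → f i + g i) ≡ Σ n f + Σ n g
Σ-+ zero    f g = refl
Σ-+ (suc n) f g = trans (cong (f 0 + g 0 +_) (Σ-+ n (f ∘ suc) (g ∘ suc))) (rearrange (f 0) (g 0) (Σ n (f ∘ suc)) (Σ n (g ∘ suc)))
  where
  rearrange : ∀ a b c d → (a + b) + (c + d) ≡ (a + c) + (b + d)
  rearrange = solve-∀

Σ-last : ∀ n (f : ℕ → ℕ) → Σ (suc n) f ≡ Σ n f + f n
Σ-last zero    f = +-comm (f 0) 0
Σ-last (suc n) f = trans (cong (f 0 +_) (Σ-last n (f ∘ suc))) (sym (+-assoc (f 0) _ _))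

Σ-extract : ∀ n j (f g : ℕ → ℕ) → j < n → (∀ i → i ≢ j → f i ≡ g i) → g j ≡ 0 →
  Σ n f ≡ f j + Σ n g
Σ-extract (suc n) zero f g _ f≗g gj≡0 =
  cong (f 0 +_) (trans (Σ-cong n (λ i → f≗g (suc i) λ ())) (cong (_+ Σ n (g ∘ suc)) (sym gj≡0)))
Σ-extract (suc n) (suc j) f g (s≤s j<n) f≗g gj≡0 = begin
  f 0 + Σ n (f ∘ suc)               ≡⟨ cong (f 0 +_) (Σ-extract n j (f ∘ suc) (g ∘ suc) j<n
                                         (λ i i≢j → f≗g (suc i) (i≢j ∘ suc-injective)) gj≡0) ⟩
  f 0 + (f (suc j) + Σ n (g ∘ suc)) ≡⟨ x∙yz≈y∙xz (f 0) (f (suc j)) _ ⟩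
  f (suc j) + (f 0 + Σ n (g ∘ suc)) ≡⟨ cong (λ v → f (suc j) + (v + Σ n (g ∘ suc))) (f≗g 0 λ ()) ⟩
  f (suc j) + Σ (suc n) g           ∎
  where open ≡-Reasoning

count-concatMap : {A : Set} (f : A → Bool) (g : ℕ → List A) (h : ℕ → ℕ) (n : ℕ) →
  count f (concatMap g (applyUpTo h n)) ≡ Σ n (λ i → count f (g (h i)))
count-concatMap f g h zero    = refl
count-concatMap f g h (suc n) =
  trans (count-++ f (g (h 0)) _) (cong (count f (g (h 0)) +_) (count-concatMap f g (h ∘ suc) n))

inRange : ℕ → ℕ → ℕ → Bool
inRange lo s j = ⌊ lo ≤? j ⌋ ∧ ⌊ j ≤? s ⌋

when-inRange≡0 : ∀ lo s j v → (lo ≤ j → j ≤ s → v ≡ 0) → v when inRange lo s j ≡ 0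
when-inRange≡0 lo s j v v≡0 with lo ≤? j | j ≤? s
... | yes lo≤j | yes j≤s = v≡0 lo≤j j≤s
... | yes _    | no _    = refl
... | no _     | _       = refl

ascFrom : ℕ → ℕ → List ℕ → Bool
ascFrom lo s []       = ⌊ 0 ≟ s ⌋
ascFrom lo s (x ∷ xs) = inRange lo s x ∧ ascFrom x (s ∸ x) xs

headAtLeast : ℕ → List ℕ → Bool
headAtLeast lo []      = true
headAtLeast lo (x ∷ _) = ⌊ lo ≤? x ⌋

nondecreasing-∷ : ∀ x xs → nondecreasing? (x ∷ xs) ≡ headAtLeast x xs ∧ nondecreasing? xs
nondecreasing-∷ x []      = refl
nondecreasing-∷ x (_ ∷ _) = refl

+-≟-split : ∀ x r s → ⌊ x + r ≟ s ⌋ ≡ ⌊ x ≤? s ⌋ ∧ ⌊ r ≟ s ∸ x ⌋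
+-≟-split x r s with x ≤? s
... | no x≰s = ⌊⌋-false (x + r ≟ s) (λ e → x≰s (subst (x ≤_) e (m≤m+n x r)))
... | yes x≤s = ⌊⌋-cong (x + r ≟ s) (r ≟ s ∸ x)
                  (λ e → trans (sym (m+n∸m≡n x r)) (cong (_∸ x) e))
                  (λ e → trans (cong (x +_) e) (m+[n∸m]≡n x≤s))

∧-shuffle : ∀ a b h d e → a ∧ ((h ∧ d) ∧ (b ∧ e)) ≡ (a ∧ b) ∧ (h ∧ (d ∧ e))
∧-shuffle false b     h d e = refl
∧-shuffle true  false h d e = ∧-zeroʳ (h ∧ d)
∧-shuffle true  true  h d e = ∧-assoc h d e

isPartition-from : ∀ lo s xs → headAtLeast lo xs ∧ isPartitionOf? s xs ≡ ascFrom lo s xs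
isPartition-from lo zero    []       = refl
isPartition-from lo (suc s) []       = refl
isPartition-from lo s       (x ∷ xs) = begin
  ⌊ lo ≤? x ⌋ ∧ (nondecreasing? (x ∷ xs) ∧ ⌊ x + sum xs ≟ s ⌋)
    ≡⟨ cong₂ (λ u v → ⌊ lo ≤? x ⌋ ∧ (u ∧ v)) (nondecreasing-∷ x xs) (+-≟-split x (sum xs) s) ⟩
  ⌊ lo ≤? x ⌋ ∧ ((headAtLeast x xs ∧ nondecreasing? xs) ∧ (⌊ x ≤? s ⌋ ∧ ⌊ sum xs ≟ s ∸ x ⌋))
    ≡⟨ ∧-shuffle ⌊ lo ≤? x ⌋ ⌊ x ≤? s ⌋ (headAtLeast x xs) (nondecreasing? xs) _ ⟩
  inRange lo s x ∧ (headAtLeast x xs ∧ isPartitionOf? (s ∸ x) xs)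
    ≡⟨ cong (inRange lo s x ∧_) (isPartition-from x (s ∸ x) xs) ⟩
  ascFrom lo s (x ∷ xs) ∎
  where open ≡-Reasoning

isPartition≡ascFrom : ∀ s xs → isPartitionOf? s xs ≡ ascFrom 0 s xs
isPartition≡ascFrom s []       = isPartition-from 0 s []
isPartition≡ascFrom s (x ∷ xs) = isPartition-from 0 s (x ∷ xs)

-- The enumeration defining p n bounds entries and lengths by n; the counts
-- below are relative to such a bound n.
module Bounded (n : ℕ) where

  -- ascLen m lo s : the number of lists of length m with entries in 1 … n
  -- that are ascending compositions of s with all parts ≥ lo.
  ascLen : ℕ → ℕ → ℕ → ℕ
  ascLen zero    lo s = 1 when ⌊ 0 ≟ s ⌋
  ascLen (suc m) lo s = Σ n (λ i → ascLen m (suc i) (s ∸ suc i) when inRange lo s (suc i))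

  count-listsOfLength : ∀ m lo s → count (ascFrom lo s) (listsOfLength n m) ≡ ascLen m lo s
  count-listsOfLength zero    lo s = refl
  count-listsOfLength (suc m) lo s =
    trans (count-concatMap (ascFrom lo s) (λ i → map (suc i ∷_) (listsOfLength n m)) (λ i → i) n)
          (Σ-cong n λ i → begin
            count (ascFrom lo s) (map (suc i ∷_) (listsOfLength n m))
              ≡⟨ count-map (ascFrom lo s) (suc i ∷_) (listsOfLength n m) ⟩
            count (λ xs → inRange lo s (suc i) ∧ ascFrom (suc i) (s ∸ suc i) xs) (listsOfLength n m)
              ≡⟨ count-guard (inRange lo s (suc i)) _ (listsOfLength n m) ⟩
            count (ascFrom (suc i) (s ∸ suc i)) (listsOfLength n m) when inRange lo s (suc i)
              ≡⟨ cong (_when inRange lo s (suc i)) (count-listsOfLength m (suc i) (s ∸ suc i)) ⟩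
            ascLen m (suc i) (s ∸ suc i) when inRange lo s (suc i) ∎)
    where open ≡-Reasoning

  asc : ℕ → ℕ → ℕ
  asc lo s = Σ (suc n) (λ m → ascLen m lo s)

  -- p n counts the compositions of n with parts ≥ 1; the final step holds by
  -- computation, since the lower bounds 0 and 1 agree on positive parts.
  p≡asc : p n ≡ asc 1 n
  p≡asc = begin
    p n                                    ≡⟨ length-filter≡count (isPartitionOf? n) (candidates n) ⟩
    count (isPartitionOf? n) (candidates n) ≡⟨ count-cong (isPartition≡ascFrom n) (candidates n) ⟩
    count (ascFrom 0 n) (candidates n)     ≡⟨ count-concatMap (ascFrom 0 n) (listsOfLength n) (λ i → i) (suc n) ⟩
    Σ (suc n) (λ m → count (ascFrom 0 n) (listsOfLength n m))
                                           ≡⟨ Σ-cong (suc n) (λ m → count-listsOfLength m 0 n) ⟩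
    asc 1 n                                ∎
    where open ≡-Reasoning

  ascLen-long : ∀ m lo s → s < m → ascLen m lo s ≡ 0
  ascLen-long (suc m) lo s (s≤s s≤m) = Σ-zero n λ i →
    when-inRange≡0 lo s (suc i) _ λ _ i<s →
      ascLen-long m (suc i) (s ∸ suc i) (<-≤-trans (∸-monoʳ-< z<s i<s) s≤m)

  ascLen-above : ∀ m lo t → t < lo → ascLen (suc m) lo t ≡ 0
  ascLen-above m lo t t<lo = Σ-zero n λ i →
    when-inRange≡0 lo t (suc i) _ λ lo≤i i≤t → contradiction (≤-trans lo≤i i≤t) (<⇒≱ t<lo)

  ascLen-split : ∀ m x y → 1 ≤ x → x ≤ n →
    ascLen (suc m) x (x + y) ≡ ascLen m x y + ascLen (suc m) (suc x) (x + y)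
  ascLen-split m (suc j) y _ j<n =
    trans (Σ-extract n j _ _ j<n same-guard first-excluded)
          (cong (_+ ascLen (suc m) (suc (suc j)) (suc j + y)) first-term)
    where
    t : ℕ
    t = suc j + y
    same-guard : ∀ i → i ≢ j →
      ascLen m (suc i) (t ∸ suc i) when inRange (suc j) t (suc i) ≡
      ascLen m (suc i) (t ∸ suc i) when inRange (suc (suc j)) t (suc i)
    same-guard i i≢j = cong (λ b → ascLen m (suc i) (t ∸ suc i) when (b ∧ ⌊ suc i ≤? t ⌋))
      (⌊⌋-cong (suc j ≤? suc i) (suc (suc j) ≤? suc i)
        (λ j≤i → s≤s (≤∧≢⇒< (≤-pred j≤i) (i≢j ∘ sym))) (≤-trans (n≤1+n (suc j))))
    first-excluded : ascLen m (suc j) (t ∸ suc j) when inRange (suc (suc j)) t (suc j) ≡ 0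
    first-excluded = when-inRange≡0 (suc (suc j)) t (suc j) _ λ j+1<j+1 _ → contradiction j+1<j+1 (<-irrefl refl)
    first-term : ascLen m (suc j) (t ∸ suc j) when inRange (suc j) t (suc j) ≡ ascLen m (suc j) y
    first-term = begin
      ascLen m (suc j) (t ∸ suc j) when inRange (suc j) t (suc j)
        ≡⟨ cong (ascLen m (suc j) (t ∸ suc j) when_)
             (cong₂ _∧_ (⌊⌋-true (suc j ≤? suc j) ≤-refl) (⌊⌋-true (suc j ≤? t) (m≤m+n (suc j) y))) ⟩
      ascLen m (suc j) (t ∸ suc j)
        ≡⟨ cong (ascLen m (suc j)) (m+n∸m≡n (suc j) y) ⟩
      ascLen m (suc j) y ∎
      where open ≡-Reasoning

  asc-zero : ∀ x → asc x 0 ≡ 1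
  asc-zero x = cong suc (Σ-zero n λ m → ascLen-long (suc m) x 0 z<s)

  asc-above : ∀ x t → suc t < x → asc x (suc t) ≡ 0
  asc-above x t t<x = Σ-zero n λ m → ascLen-above m x (suc t) t<x

  asc-split : ∀ x y → 1 ≤ x → x + y ≤ n → asc x (x + y) ≡ asc x y + asc (suc x) (x + y)
  -- (The length-0 terms vanish as x + y > 0, so the sums start at length 1.)
  asc-split x@(suc _) y 1≤x x+y≤n = begin
    Σ n (λ m → ascLen (suc m) x (x + y))
      ≡⟨ Σ-cong n (λ m → ascLen-split m x y 1≤x (≤-trans (m≤m+n x y) x+y≤n)) ⟩
    Σ n (λ m → ascLen m x y + ascLen (suc m) (suc x) (x + y))
      ≡⟨ Σ-+ n _ _ ⟩
    Σ n (λ m → ascLen m x y) + Σ n (λ m → ascLen (suc m) (suc x) (x + y))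
      ≡⟨ cong (_+ Σ n (λ m → ascLen (suc m) (suc x) (x + y))) (sym no-longest) ⟩
    asc x y + asc (suc x) (x + y) ∎
    where
    open ≡-Reasoning
    -- a composition of y has fewer than n parts, since y < x + y ≤ n
    no-longest : asc x y ≡ Σ n (λ m → ascLen m x y)
    no-longest = trans (Σ-last n (λ m → ascLen m x y))
      (trans (cong (Σ n (λ m → ascLen m x y) +_) (ascLen-long n x y (<-≤-trans (m<n+m y z<s) x+y≤n)))
             (+-identityʳ _))

  asc-single : ∀ x d → 1 ≤ x → d < x → x + d ≤ n → asc x (x + d) ≡ 1
  asc-single x@(suc j) zero 1≤x _ x≤n = begin
    asc x (x + 0)                   ≡⟨ asc-split x 0 1≤x x≤n ⟩
    asc x 0 + asc (suc x) (x + 0)   ≡⟨ cong₂ _+_ (asc-zero x) (asc-above (suc x) (j + 0) (s≤s (s≤s (≤-reflexive (+-identityʳ j))))) ⟩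
    1                               ∎
    where open ≡-Reasoning
  asc-single x@(suc _) (suc d) 1≤x d<x x+d≤n = begin
    asc x (x + suc d)                     ≡⟨ asc-split x (suc d) 1≤x x+d≤n ⟩
    asc x (suc d) + asc (suc x) (x + suc d) ≡⟨ cong₂ _+_ (asc-above x d d<x) (cong (asc (suc x)) (+-suc x d)) ⟩
    asc (suc x) (suc x + d)               ≡⟨ asc-single (suc x) d z<s (<-trans (<-trans (n<1+n d) d<x) (n<1+n x))
                                               (subst (_≤ n) (+-suc x d) x+d≤n) ⟩
    1                                     ∎
    where open ≡-Reasoning

  -- For x ≤ y < 2x, the compositions of x + y with parts ≥ x and first part x
  -- reduce to ⟨x, y⟩ alone.
  asc-first-pair : ∀ x y → 1 ≤ x → x ≤ y → y < x + x → x + y ≤ n →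
    asc x (x + y) ≡ suc (asc (suc x) (x + y))
  asc-first-pair x@(suc _) y 1≤x x≤y y<2x x+y≤n = begin
    asc x (x + y)                      ≡⟨ asc-split x y 1≤x x+y≤n ⟩
    asc x y + asc (suc x) (x + y)      ≡⟨ cong (λ z → asc x z + asc (suc x) (x + y)) (sym (m+[n∸m]≡n x≤y)) ⟩
    asc x (x + (y ∸ x)) + asc (suc x) (x + y)
      ≡⟨ cong (_+ asc (suc x) (x + y))
           (asc-single x (y ∸ x) 1≤x (m<n+o⇒m∸n<o y x y<2x)
             (subst (_≤ n) (sym (m+[n∸m]≡n x≤y)) (≤-trans (m≤n+m y x) x+y≤n))) ⟩
    suc (asc (suc x) (x + y))          ∎
    where open ≡-Reasoning

data _↝_ : State → State → Set where
  done : ∀ {s} → s ↝ s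
  next : ∀ {s s′ u} → State.pc s ≢ halt → step s ≡ s′ → s′ ↝ u → s ↝ u

↝-trans : ∀ {s u v} → s ↝ u → u ↝ v → s ↝ v
↝-trans done             u↝v = u↝v
↝-trans (next h e s′↝u) u↝v = next h e (↝-trans s′↝u u↝v)

run-step : ∀ fuel s → State.pc s ≢ halt → run (suc fuel) s ≡ run fuel (step s)
run-step fuel (st outer _ _ _ _ _ _) _        = refl
run-step fuel (st loop1 _ _ _ _ _ _) _        = refl
run-step fuel (st loop2 _ _ _ _ _ _) _        = refl
run-step fuel (st halt  _ _ _ _ _ _) pc≢halt = contradiction refl pc≢halt

halts-with : ∀ {s a k x y ℓ w} → s ↝ st halt a k x y ℓ w → ∃[ fuel ] run fuel s ≡ just w
halts-with done = 0 , refl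
halts-with (next {s} pc≢halt refl s′↝halt) with halts-with s′↝halt
... | fuel , ran = suc fuel , trans (run-step fuel s pc≢halt) ran

step-loop1-yes : ∀ {a k x y ℓ w} → 2 * x ≤ y →
  step (st loop1 a k x y ℓ w) ≡ st loop1 (upd a k x) (suc k) x (y ∸ x) ℓ (suc w)
step-loop1-yes {x = x} {y} 2x≤y with 2 * x ≤? y
... | yes _    = refl
... | no 2x≰y = contradiction 2x≤y 2x≰y

step-loop1-no : ∀ {a k x y ℓ w} → ¬ 2 * x ≤ y →
  step (st loop1 a k x y ℓ w) ≡ st loop2 a k x y (suc k) w
step-loop1-no {x = x} {y} 2x≰y with 2 * x ≤? y
... | yes 2x≤y = contradiction 2x≤y 2x≰y
... | no _     = refl

step-loop2-yes : ∀ {a k x y ℓ w} → x ≤ y →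
  step (st loop2 a k x y ℓ w) ≡ st loop2 (upd (upd a k x) ℓ y) k (suc x) (y ∸ 1) ℓ (2 + w)
step-loop2-yes {x = x} {y} x≤y with x ≤? y
... | yes _   = refl
... | no x≰y = contradiction x≤y x≰y

step-loop2-no : ∀ {a k x y ℓ w} → ¬ x ≤ y →
  step (st loop2 a k x y ℓ w) ≡ st outer (upd a k (suc (y + x ∸ 1))) k x (y + x ∸ 1) ℓ (suc w)
step-loop2-no {x = x} {y} x≰y with x ≤? y
... | yes x≤y = contradiction x≤y x≰y
... | no _    = refl

upd-same : ∀ a i v → upd a i v i ≡ v
upd-same a i v = cong (if_then v else a i) (⌊⌋-true (i ≟ i) refl)

upd-other : ∀ a i v j → j ≢ i → upd a i v j ≡ a j
upd-other a i v j j≢i = cong (if_then v else a j) (⌊⌋-false (j ≟ i) j≢i)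

upd-below : ∀ a k v j → j < k → upd a k v j ≡ a j
upd-below a k v j j<k = upd-other a k v j (<⇒≢ j<k)

suc-∸1 : ∀ m → 1 ≤ m → suc (m ∸ 1) ≡ m
suc-∸1 (suc m) _ = refl

shift-unit : ∀ x y → 1 ≤ y → suc x + (y ∸ 1) ≡ x + y
shift-unit x y 1≤y = trans (sym (+-suc x (y ∸ 1))) (cong (x +_) (suc-∸1 y 1≤y))

record Returns (a : ℕ → ℕ) (k t w c : ℕ) (s : State) : Set where
  field
    arr′         : ℕ → ℕ
    x′ y′ ℓ′ w′ : ℕ
    reaches      : s ↝ st outer arr′ k x′ y′ ℓ′ w′
    y′≡          : y′ ≡ t ∸ 1
    below        : ∀ j → j < k → arr′ j ≡ a j
    at-level     : arr′ k ≡ t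
    writes       : suc w′ ≡ w + 2 * c

open Returns

prepend : ∀ {a a′ k t w w′ c c′ s s′} → State.pc s ≢ halt → step s ≡ s′ →
  (∀ j → j < k → a′ j ≡ a j) → w′ + 2 * c′ ≡ w + 2 * c →
  Returns a′ k t w′ c′ s′ → Returns a k t w c s
prepend pc≢halt stepped unchanged counted r = record
  { reaches  = next pc≢halt stepped (reaches r)
  ; y′≡      = y′≡ r
  ; below    = λ j j<k → trans (below r j j<k) (unchanged j j<k)
  ; at-level = at-level r
  ; writes   = trans (writes r) counted
  }

writes-compose : ∀ {w w₁ w₂} A B → suc w₁ ≡ suc w + 2 * A → suc w₂ ≡ w₁ + 2 * B →
  suc w₂ ≡ w + 2 * (A + B)
writes-compose {w} {w₁} {w₂} A B counted₁ counted₂ = begin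
  suc w₂            ≡⟨ counted₂ ⟩
  w₁ + 2 * B        ≡⟨ cong (_+ 2 * B) (suc-injective counted₁) ⟩
  w + 2 * A + 2 * B ≡⟨ distribute w A B ⟩
  w + 2 * (A + B)   ∎
  where
  open ≡-Reasoning
  distribute : ∀ w A B → w + 2 * A + 2 * B ≡ w + 2 * (A + B)
  distribute = solve-∀

-- The invariant of AccelAsc(n).  Both loops are proved by recursion on an
-- upper bound for y, which strictly decreases between recursive calls.
module Execution (n : ℕ) where
  open Bounded n

  -- The second inner loop (entered when y < 2x) returns after 2·asc x t − 1 writes:
  -- each pass writes the composition ⟨x, y⟩, the exit writes ⟨x + y⟩.
  loop2-returns : ∀ bound x y t a k w → y < bound → x + y ≡ t → 1 ≤ x → y < x + x → t ≤ n →
    Returns a k t w (asc x t) (st loop2 a k x y (suc k) w)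
  loop2-returns (suc bound) x y _ a k w (s≤s y≤bound) refl 1≤x y<2x t≤n with x ≤? y
  ... | yes x≤y = prepend (λ ()) (step-loop2-yes x≤y) unchanged counted
        (loop2-returns bound (suc x) (y ∸ 1) (x + y) _ k (2 + w) y∸1<bound (shift-unit x y 1≤y) z<s
          (≤-<-trans (m∸n≤m y 1) (<-≤-trans y<2x (+-mono-≤ (n≤1+n x) (n≤1+n x)))) t≤n)
    where
    1≤y : 1 ≤ y
    1≤y = ≤-trans 1≤x x≤y
    y∸1<bound : y ∸ 1 < bound
    y∸1<bound = <-≤-trans (∸-monoʳ-< z<s 1≤y) y≤bound
    unchanged : ∀ j → j < k → upd (upd a k x) (suc k) y j ≡ a j
    unchanged j j<k = trans (upd-below (upd a k x) (suc k) y j (<-trans j<k (n<1+n k))) (upd-below a k x j j<k)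
    counted : 2 + w + 2 * asc (suc x) (x + y) ≡ w + 2 * asc x (x + y)
    counted = trans (two-more w _) (cong (λ c → w + 2 * c) (sym (asc-first-pair x y 1≤x x≤y y<2x t≤n)))
      where
      two-more : ∀ w c → 2 + w + 2 * c ≡ w + 2 * suc c
      two-more = solve-∀
  ... | no x≰y = record
    { reaches  = next (λ ()) (step-loop2-no x≰y) done
    ; y′≡      = cong (_∸ 1) (+-comm y x)
    ; below    = upd-below a k _
    ; at-level = trans (upd-same a k _) (trans (suc-∸1 (y + x) (≤-trans 1≤x (m≤n+m x y))) (+-comm y x))
    ; writes   = trans (+-comm 2 w) (cong (λ c → w + 2 * c) (sym (asc-single x y 1≤x (≰⇒> x≰y) t≤n)))
    }

  -- The first inner loop returns after 2·asc x t − 1 writes, following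
  -- asc x (x + y) = asc x y + asc (x + 1) (x + y): it writes a_k ← x, recurses one
  -- level up on the remainder y, and resumes at level k with part x + 1.
  loop1-returns : ∀ bound x y t a k ℓ w → y < bound → x + y ≡ t → 1 ≤ x → t ≤ n →
    Returns a (suc k) t w (asc x t) (st loop1 a (suc k) x y ℓ w)
  loop1-returns (suc bound) x y _ a k ℓ w (s≤s y≤bound) refl 1≤x t≤n with 2 * x ≤? y
  ... | no 2x≰y = prepend (λ ()) (step-loop1-no 2x≰y) (λ _ _ → refl) refl
        (loop2-returns (suc y) x y (x + y) a (suc k) w ≤-refl refl 1≤x
          (subst (y <_) (cong (x +_) (+-identityʳ x)) (≰⇒> 2x≰y)) t≤n)
  ... | yes 2x≤y = record
    { reaches  = next (λ ()) (step-loop1-yes 2x≤y) (↝-trans (reaches first) (next (λ ()) resume (reaches rest)))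
    ; y′≡      = y′≡ rest
    ; below    = λ j j<K → trans (below rest j j<K)
                   (trans (below first j (<-trans j<K (n<1+n K))) (upd-below a K x j j<K))
    ; at-level = at-level rest
    ; writes   = trans (writes-compose {w = w} (asc x y) (asc (suc x) (x + y)) (writes first) (writes rest))
                   (cong (λ c → w + 2 * c) (sym (asc-split x y 1≤x t≤n)))
    }
    where
    K : ℕ
    K = suc k
    x≤y : x ≤ y
    x≤y = ≤-trans (m≤m+n x (x + 0)) 2x≤y
    1≤y : 1 ≤ y
    1≤y = ≤-trans 1≤x x≤y
    first : Returns (upd a K x) (suc K) y (suc w) (asc x y) (st loop1 (upd a K x) (suc K) x (y ∸ x) ℓ (suc w))
    first = loop1-returns bound x (y ∸ x) y (upd a K x) K ℓ (suc w)
              (<-≤-trans (∸-monoʳ-< 1≤x x≤y) y≤bound) (m+[n∸m]≡n x≤y) 1≤x (≤-trans (m≤n+m y x) t≤n)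
    -- back at the outer test one level up, the next candidate part is a_K + 1 = x + 1
    resume : step (st outer (arr′ first) (suc K) (x′ first) (y′ first) (ℓ′ first) (w′ first))
           ≡ st loop1 (arr′ first) K (suc x) (y′ first) (ℓ′ first) (w′ first)
    resume = cong (λ v → st loop1 (arr′ first) K v (y′ first) (ℓ′ first) (w′ first))
               (trans (+-comm _ 1) (cong suc (trans (below first K (n<1+n K)) (upd-same a K x))))
    rest : Returns (arr′ first) K (x + y) (w′ first) (asc (suc x) (x + y))
             (st loop1 (arr′ first) K (suc x) (y′ first) (ℓ′ first) (w′ first))
    rest = loop1-returns bound (suc x) (y′ first) (x + y) (arr′ first) k (ℓ′ first) (w′ first)
             (subst (_< bound) (sym (y′≡ first)) (<-≤-trans (∸-monoʳ-< z<s 1≤y) y≤bound))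
             (trans (cong (suc x +_) (y′≡ first)) (shift-unit x y 1≤y)) z<s t≤n

-- Initialisation enters the inner loops at level 1 with x = 1 and y = n − 1;
-- these return to the outer test at level 1, which halts.  The write count
-- 2·asc 1 n − 1 is 2p(n) − 1.
theorem4p12 : (n : ℕ) → 1 ≤ n →
    ∃[ fuel ] run fuel (initState n) ≡ just (2 * p n ∸ 1)
theorem4p12 n 1≤n = map₂ (λ ran → trans ran (cong just total)) halted
  where
  open Bounded n
  open Execution n
  a₀ : ℕ → ℕ
  a₀ = upd (λ _ → 0) 1 0
  whole : Returns a₀ 1 n 0 (asc 1 n) (st loop1 a₀ 1 1 (n ∸ 1) 0 0)
  whole = loop1-returns (suc (n ∸ 1)) 1 (n ∸ 1) n a₀ 0 0 0 ≤-refl (m+[n∸m]≡n 1≤n) ≤-refl ≤-refl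
  halted : ∃[ fuel ] run fuel (initState n) ≡ just (w′ whole)
  halted = halts-with (next {s = initState n} (λ ()) refl (↝-trans (reaches whole) (next (λ ()) refl done)))
  total : w′ whole ≡ 2 * p n ∸ 1
  total = trans (cong (_∸ 1) (writes whole)) (cong (λ c → 2 * c ∸ 1) (sym p≡asc))
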